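{- Let $p\equiv 1 \pmod 4$ be a prime such that the multiplicative order of $2$ modulo $p$ is divisible by $4$. Then the edge set of the complete graph $K_p$ can be partitioned into pairwise edge-disjoint copies of $C_p^2$. Moreover, the hypothesis on the order of $2$ holds in particular for every prime $p\equiv 5\pmod 8$.
   Context: $C_p^2$ denotes the square of the cycle $C_p$ on $p$ vertices, i.e. the graph on the vertices of $C_p$ in which two vertices are adjacent if their distance in $C_p$ is at most two (the square of a Hamilton cycle of $K_p$). -}

module Defs where

open import Data.Nat using (ℕ; zero; suc; _+_; _∸_; _^_; _<_; _%_)
open import Data.Nat.Divisibility using (_∣_)
open import Data.Nat.Primality using (Prime)
open import Data.Fin using (Fin; toℕ)
open import Data.Product using (Σ; ∃; _×_; _,_)
open import Data.Sum using (_⊎_)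
open import Function.Definitions using (Injective)
open import Relation.Binary.PropositionalEquality using (_≡_)
open import Relation.Nullary using (¬_)

IsOrderOf2Mod : ℕ → ℕ → Set
IsOrderOf2Mod p k =
  (0 < k) × (p ∣ (2 ^ k ∸ 1)) × (∀ j → 0 < j → j < k → ¬ (p ∣ (2 ^ j ∸ 1)))

-- Positions i, j of Fin p are at cyclic distance d "forward": j ≡ i + d (mod p)
-- (for d < p), expressed without division.
StepMod : (p : ℕ) → ℕ → Fin p → Fin p → Set
StepMod p d i j = (toℕ j ≡ toℕ i + d) ⊎ (toℕ j + p ≡ toℕ i + d)

SqAdj : (p : ℕ) → Fin p → Fin p → Set
SqAdj p i j = StepMod p 1 i j ⊎ StepMod p 2 i j

-- A copy of C_p^2 in K_p (vertex set Fin p) is given by a Hamilton cycle of K_p,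
-- i.e. an injective (hence bijective) labelling f : Fin p → Fin p of the
-- cycle positions; its edges are {f i, f j} for positions i, j adjacent in C_p^2.
record SquareCycle (p : ℕ) : Set where
  constructor sqcyc
  field
    lab : Fin p → Fin p
    lab-inj : Injective _≡_ _≡_ lab

open SquareCycle public

EdgeIn : {p : ℕ} → SquareCycle p → Fin p → Fin p → Set
EdgeIn {p} C u v = Σ (Fin p) λ i → Σ (Fin p) λ j →
  SqAdj p i j × ((lab C i ≡ u × lab C j ≡ v) ⊎ (lab C i ≡ v × lab C j ≡ u))

SquareCycleDecomposition : ℕ → Set
SquareCycleDecomposition p =
  Σ ℕ λ k → Σ (Fin k → SquareCycle p) λ C →
    ∀ (u v : Fin p) → ¬ (u ≡ v) →
      Σ (Fin k) λ c → EdgeIn (C c) u v × (∀ c′ → EdgeIn (C c′) u v → c′ ≡ c)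

-- Label the vertices of K_p by the residues mod p. For a ≢ 0 the relabelling i ↦ a·i of
-- the standard C_p^2 is a copy whose edges are the pairs {u, v} with v − u ∈ {±a, ±2a}, so
-- it suffices to pick multipliers a whose blocks {±a, ±2a} partition the nonzero residues.
-- Let k = ord_p(2) with 4 ∣ k. Every coset of ⟨2⟩ is a cycle x, 2x, …, 2^(k−1)x; counting
-- positions from its least residue, multiplication by −1 = 2^(k/2) shifts positions by the
-- even number k/2, so the blocks of the elements at even positions partition the coset.
-- For p ≡ 5 (mod 8), Gauss's lemma gives 2^((p−1)/2) ≡ −1, and since (p−1)/2 ≡ 2 (mod 4)
-- the order of 2 is divisible by 4.

module Submission where

open import Defs
open import Data.Fin using (Fin; toℕ; fromℕ<; zero; suc)
import Data.Fin.Properties as FinP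
open import Data.Integer as ℤ using (ℤ; +_; -_; _+_; _-_; _*_; _^_; 0ℤ; 1ℤ)
import Data.Integer.DivMod as ℤD
open import Data.Integer.Divisibility.Signed as ℤD∣ using () renaming (_∣_ to _∣ᶻ_)
import Data.Integer.Properties as ℤP
open import Data.Integer.Tactic.RingSolver using (solve-∀)
open import Data.List using (List; _∷_; upTo; filter; length; lookup)
open import Data.List.Extrema.Nat using (argmin; argmin-all; f[argmin]≤f[xs])
open import Data.List.Membership.Propositional using (_∈_)
open import Data.List.Membership.Propositional.Properties using (∈-filter⁺; ∈-filter⁻; ∈-upTo⁺; ∈-lookup)
import Data.List.Relation.Unary.All as All
open import Data.List.Relation.Unary.All.Properties using (applyUpTo⁺₁; applyUpTo⁻)
open import Data.List.Relation.Unary.AllPairs using (_∷_)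
import Data.List.Relation.Unary.Any as Any
open import Data.List.Relation.Unary.Any.Properties using (lookup-index)
open import Data.List.Relation.Unary.Unique.Propositional using (Unique)
import Data.List.Relation.Unary.Unique.Propositional.Properties as UniqueP
open import Data.Nat as ℕ using (ℕ; zero; suc; _≤_; _<_; _%_; _/_; _⊓_; _!; NonZero; z≤n; s≤s; parity)
open import Data.Nat.Coprimality using (coprime-Bézout; prime⇒coprime)
open import Data.Nat.Divisibility as ℕD using (_∣_; divides)
import Data.Nat.DivMod as ℕ%
open import Data.Nat.GCD using (module Bézout)
open import Data.Nat.Induction using (<-rec)
open import Data.Nat.Primality using (Prime; prime?; ¬prime[1]; euclidsLemma; prime⇒nonZero; prime⇒nonTrivial)
import Data.Nat.Properties as ℕP
import Data.Nat.Tactic.RingSolver as ℕSolver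
open import Data.Parity.Base as ℙ using (Parity; 0ℙ; 1ℙ)
import Data.Parity.Properties as ℙP
open import Data.Product using (Σ; ∃; ∃-syntax; _×_; _,_; proj₁; proj₂; map₁; map₂)
open import Data.Sum as Sum using (_⊎_; inj₁; inj₂; [_,_]′)
open import Function using (flip; id)
open import Function.Definitions using (Injective)
open import Relation.Binary using (Setoid; IsEquivalence)
open import Relation.Binary.PropositionalEquality
  using (_≡_; _≢_; refl; sym; trans; cong; cong₂; subst; module ≡-Reasoning)
import Relation.Binary.Reasoning.Setoid as SetoidReasoning
open import Relation.Nullary using (¬_; contradiction; yes; no)
open import Relation.Nullary.Decidable using (_×-dec_; from-yes)
open import Relation.Unary using (Decidable)

n<m⇒m∣n⇒n≡0 : ∀ {m n} → n < m → m ∣ n → n ≡ 0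
n<m⇒m∣n⇒n≡0 {n = zero}  _   _   = refl
n<m⇒m∣n⇒n≡0 {n = suc n} n<m m∣n = contradiction m∣n (ℕD.>⇒∤ n<m)

%-wrap : ∀ {m n} .{{_ : NonZero m}} → n < m ℕ.+ m → n % m ≡ n ⊎ n % m ℕ.+ m ≡ n
%-wrap {m} {n} n<2m with n ℕ.<? m
... | yes n<m = inj₁ (ℕ%.m<n⇒m%n≡m n<m)
... | no  n≮m = inj₂ (begin
  n % m ℕ.+ m           ≡⟨ cong (ℕ._+ m) (ℕ%.m≤n⇒[n∸m]%m≡n%m m≤n) ⟨
  (n ℕ.∸ m) % m ℕ.+ m   ≡⟨ cong (ℕ._+ m) (ℕ%.m<n⇒m%n≡m n∸m<m) ⟩
  n ℕ.∸ m ℕ.+ m         ≡⟨ ℕP.m∸n+n≡m m≤n ⟩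
  n                     ∎)
  where
  open ≡-Reasoning
  m≤n = ℕP.≮⇒≥ n≮m
  n∸m<m : n ℕ.∸ m < m
  n∸m<m = ℕP.+-cancelʳ-< m (n ℕ.∸ m) m (subst (_< m ℕ.+ m) (sym (ℕP.m∸n+n≡m m≤n)) n<2m)

least-witness : ∀ {P : ℕ → Set} → Decidable P → ∀ {n} → P n → ∃[ m ] P m × (∀ {j} → j < m → ¬ P j)
least-witness {P} P? {n} = <-rec (λ n → P n → Least) search n
  where
  Least = ∃[ m ] P m × (∀ {j} → j < m → ¬ P j)
  search : ∀ n → (∀ {j} → j < n → P j → Least) → P n → Least
  search n smaller pn with ℕP.anyUpTo? P? n
  ... | yes (j , j<n , pj) = smaller j<n pj
  ... | no  none           = n , pn , λ j<n pj → none (_ , j<n , pj)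

2∣-odd-factor : ∀ {m n} → ¬ 2 ∣ m → 2 ∣ m ℕ.* n → 2 ∣ n
2∣-odd-factor {m} {n} 2∤m 2∣mn = [ flip contradiction 2∤m , id ]′ (euclidsLemma m n 2-prime 2∣mn)
  where
  2-prime : Prime 2
  2-prime = from-yes (prime? 2)

4∣-of-halving : ∀ {k n} → k ∣ 2 ℕ.* n → ¬ k ∣ n → 2 ∣ n → 4 ∣ k
4∣-of-halving {k} {n} (divides m 2n≡mk) k∤n 2∣n = 4∣k (2∣-odd-factor 2∤m (ℕD.∣-trans (divides 2 refl) 4∣mk))
  where
  2∤m : ¬ 2 ∣ m
  2∤m 2∣m = k∤n (ℕD.*-cancelˡ-∣ 2 (subst (2 ℕ.* k ∣_) (sym 2n≡mk) (ℕD.*-monoˡ-∣ k 2∣m)))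
  4∣mk : 4 ∣ m ℕ.* k
  4∣mk = subst (4 ∣_) 2n≡mk (ℕD.*-monoʳ-∣ 2 2∣n)
  4∣k : 2 ∣ k → 4 ∣ k
  4∣k (divides k′ refl) = ℕD.*-monoˡ-∣ 2 2∣k′
    where
    m[k′*2]≡2[mk′] : m ℕ.* (k′ ℕ.* 2) ≡ 2 ℕ.* (m ℕ.* k′)
    m[k′*2]≡2[mk′] = trans (sym (ℕP.*-assoc m k′ 2)) (ℕP.*-comm (m ℕ.* k′) 2)
    2∣k′ : 2 ∣ k′
    2∣k′ = 2∣-odd-factor 2∤m (ℕD.*-cancelˡ-∣ 2 (subst (4 ∣_) m[k′*2]≡2[mk′] 4∣mk))

prod : ℕ → (ℕ → ℕ) → ℕ
prod zero    f = 1
prod (suc n) f = prod n f ℕ.* f n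

prod-+ : ∀ m n f → prod (m ℕ.+ n) f ≡ prod m f ℕ.* prod n (λ i → f (m ℕ.+ i))
prod-+ m zero    f = trans (cong (λ n → prod n f) (ℕP.+-identityʳ m)) (sym (ℕP.*-identityʳ (prod m f)))
prod-+ m (suc n) f = begin
  prod (m ℕ.+ suc n) f                                      ≡⟨ cong (λ n → prod n f) (ℕP.+-suc m n) ⟩
  prod (m ℕ.+ n) f ℕ.* f (m ℕ.+ n)                          ≡⟨ cong (ℕ._* f (m ℕ.+ n)) (prod-+ m n f) ⟩
  prod m f ℕ.* prod n (λ i → f (m ℕ.+ i)) ℕ.* f (m ℕ.+ n)   ≡⟨ ℕP.*-assoc (prod m f) _ (f (m ℕ.+ n)) ⟩
  prod m f ℕ.* prod (suc n) (λ i → f (m ℕ.+ i))             ∎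
  where open ≡-Reasoning

evens : ℕ → ℕ
evens n = prod n (λ i → 2 ℕ.* i ℕ.+ 2)

odds : ℕ → ℕ
odds n = prod n (λ i → 2 ℕ.* i ℕ.+ 1)

evens≡2^*! : ∀ n → evens n ≡ 2 ℕ.^ n ℕ.* n !
evens≡2^*! zero    = refl
evens≡2^*! (suc n) = trans (cong (ℕ._* (2 ℕ.* n ℕ.+ 2)) (evens≡2^*! n)) (eq n (2 ℕ.^ n) (n !))
  where eq : ∀ n a b → a ℕ.* b ℕ.* (2 ℕ.* n ℕ.+ 2) ≡ 2 ℕ.* a ℕ.* (suc n ℕ.* b)
        eq = ℕSolver.solve-∀

[n+n]!≡evens*odds : ∀ n → (n ℕ.+ n) ! ≡ evens n ℕ.* odds n
[n+n]!≡evens*odds zero    = refl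
[n+n]!≡evens*odds (suc n) = begin
  (suc n ℕ.+ suc n) !                                 ≡⟨ cong (λ m → suc m !) (ℕP.+-suc n n) ⟩
  (2 ℕ.+ N) ℕ.* ((1 ℕ.+ N) ℕ.* N !)
    ≡⟨ cong (λ x → (2 ℕ.+ N) ℕ.* ((1 ℕ.+ N) ℕ.* x)) ([n+n]!≡evens*odds n) ⟩
  (2 ℕ.+ N) ℕ.* ((1 ℕ.+ N) ℕ.* (E ℕ.* O))             ≡⟨ eq n E O ⟩
  E ℕ.* (2 ℕ.* n ℕ.+ 2) ℕ.* (O ℕ.* (2 ℕ.* n ℕ.+ 1))   ∎
  where
  open ≡-Reasoning
  N = n ℕ.+ n
  E = evens n
  O = odds n
  eq : ∀ n e o → (2 ℕ.+ (n ℕ.+ n)) ℕ.* ((1 ℕ.+ (n ℕ.+ n)) ℕ.* (e ℕ.* o))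
                ≡ e ℕ.* (2 ℕ.* n ℕ.+ 2) ℕ.* (o ℕ.* (2 ℕ.* n ℕ.+ 1))
  eq = ℕSolver.solve-∀

lookup-injective : ∀ {A : Set} {xs : List A} → Unique xs → ∀ {i j} → lookup xs i ≡ lookup xs j → i ≡ j
lookup-injective {xs = _ ∷ _} (_    ∷ _)      {zero}  {zero}  _  = refl
lookup-injective {xs = _ ∷ _} (x∉xs ∷ _)      {zero}  {suc j} eq = contradiction eq (All.lookup x∉xs (∈-lookup j))
lookup-injective {xs = _ ∷ _} (x∉xs ∷ _)      {suc i} {zero}  eq = contradiction (sym eq) (All.lookup x∉xs (∈-lookup i))
lookup-injective {xs = _ ∷ _} (_    ∷ unique) {suc i} {suc j} eq = cong suc (lookup-injective unique eq)

module Congruence (p : ℕ) .{{_ : NonZero p}} where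

  infix 4 _≈_ _≉_

  -- A record rather than a synonym for + p ∣ a - b, so that a and b can be inferred.
  record _≈_ (a b : ℤ) : Set where
    constructor mk≈
    field divides-difference : + p ∣ᶻ a - b

  _≉_ : ℤ → ℤ → Set
  a ≉ b = ¬ (a ≈ b)

  private
    variable a b c d x : ℤ

    ≈-by : (p∣ : + p ∣ᶻ x) → x ≡ a - b → a ≈ b
    ≈-by p∣ refl = mk≈ p∣

  ≈-reflexive : a ≡ b → a ≈ b
  ≈-reflexive {a} refl = mk≈ (ℤD∣.divides 0ℤ (ℤP.+-inverseʳ a))

  ≈-refl : a ≈ a
  ≈-refl = ≈-reflexive refl

  ≈-sym : a ≈ b → b ≈ a
  ≈-sym {a} {b} (mk≈ d) = ≈-by (ℤD∣.∣m⇒∣-m d) (eq a b)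
    where eq : ∀ a b → - (a - b) ≡ b - a
          eq = solve-∀

  ≈-trans : a ≈ b → b ≈ c → a ≈ c
  ≈-trans {a} {b} {c} (mk≈ d) (mk≈ e) = ≈-by (ℤD∣.∣m∣n⇒∣m+n d e) (eq a b c)
    where eq : ∀ a b c → (a - b) + (b - c) ≡ a - c
          eq = solve-∀

  ≈-isEquivalence : IsEquivalence _≈_
  ≈-isEquivalence = record { refl = ≈-refl ; sym = ≈-sym ; trans = ≈-trans }

  ≈-setoid : Setoid _ _
  ≈-setoid = record { isEquivalence = ≈-isEquivalence }

  +-cong : a ≈ b → c ≈ d → a + c ≈ b + d
  +-cong {a} {b} {c} {d} (mk≈ x) (mk≈ y) = ≈-by (ℤD∣.∣m∣n⇒∣m+n x y) (eq a b c d)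
    where eq : ∀ a b c d → (a - b) + (c - d) ≡ (a + c) - (b + d)
          eq = solve-∀

  *-cong : a ≈ b → c ≈ d → a * c ≈ b * d
  *-cong {a} {b} {c} {d} (mk≈ x) (mk≈ y) =
    ≈-by (ℤD∣.∣m∣n⇒∣m+n (ℤD∣.∣m⇒∣m*n c x) (ℤD∣.∣n⇒∣m*n b y)) (eq a b c d)
    where eq : ∀ a b c d → (a - b) * c + b * (c - d) ≡ a * c - b * d
          eq = solve-∀

  -‿cong : a ≈ b → - a ≈ - b
  -‿cong {a} {b} (mk≈ x) = ≈-by (ℤD∣.∣m⇒∣-m x) (eq a b)
    where eq : ∀ a b → - (a - b) ≡ - a - - b
          eq = solve-∀

  *-congˡ : ∀ a → b ≈ c → a * b ≈ a * c
  *-congˡ a = *-cong (≈-refl {a})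

  *-congʳ : ∀ a → b ≈ c → b * a ≈ c * a
  *-congʳ a b≈c = *-cong b≈c (≈-refl {a})

  +-multiple : ∀ a q → a + q * + p ≈ a
  +-multiple a q = ≈-by (ℤD∣.divides q refl) (eq a q (+ p))
    where eq : ∀ a q P → q * P ≡ a + q * P - a
          eq = solve-∀

  ≈0⇒∣ : ∀ a → a ≈ 0ℤ → p ∣ ℤ.∣ a ∣
  ≈0⇒∣ a (mk≈ d) = ℤD∣.∣⇒∣ᵤ (subst (+ p ∣ᶻ_) (ℤP.+-identityʳ a) d)

  ∣⇒≈0 : ∀ a → p ∣ ℤ.∣ a ∣ → a ≈ 0ℤ
  ∣⇒≈0 a d = ≈-by (ℤD∣.∣ᵤ⇒∣ d) (sym (ℤP.+-identityʳ a))

  ≈⇒-≈0 : a ≈ b → a - b ≈ 0ℤ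
  ≈⇒-≈0 {a} {b} (mk≈ d) = ≈-by d (sym (ℤP.+-identityʳ (a - b)))

  -≈0⇒≈ : a - b ≈ 0ℤ → a ≈ b
  -≈0⇒≈ {a} {b} (mk≈ d) = ≈-by d (ℤP.+-identityʳ (a - b))

  module ≈-Reasoning = SetoidReasoning ≈-setoid

  residue : ℤ → ℕ
  residue a = a ℤ.%ℕ p

  residue<p : ∀ a → residue a < p
  residue<p a = ℤD.n%ℕd<d a p

  residue-≈ : ∀ a → + residue a ≈ a
  residue-≈ a = ≈-sym (subst (_≈ + residue a) (sym (ℤD.a≡a%ℕn+[a/ℕn]*n a p))
                              (+-multiple (+ residue a) (a ℤ./ℕ p)))

  ≈⇒≡ : ∀ {m n} → m < p → n < p → + m ≈ + n → m ≡ n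
  ≈⇒≡ {m} {n} m<p n<p m≈n = ℤP.+-injective (ℤP.i-j≡0⇒i≡j (+ m) (+ n) (ℤP.∣i∣≡0⇒i≡0 ∣m-n∣≡0))
    where
    ∣m-n∣≡∣m⊖n∣ : ℤ.∣ + m - + n ∣ ≡ ℤ.∣ m ℤ.⊖ n ∣
    ∣m-n∣≡∣m⊖n∣ = cong ℤ.∣_∣ (ℤP.[+m]-[+n]≡m⊖n m n)
    ∣m-n∣<p : ℤ.∣ + m - + n ∣ < p
    ∣m-n∣<p = subst (_< p) (sym ∣m-n∣≡∣m⊖n∣)
                (ℕP.≤-<-trans (ℤP.∣m⊝n∣≤m⊔n m n) (ℕP.⊔-pres-<m m<p n<p))
    ∣m-n∣≡0 : ℤ.∣ + m - + n ∣ ≡ 0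
    ∣m-n∣≡0 = n<m⇒m∣n⇒n≡0 ∣m-n∣<p (≈0⇒∣ (+ m - + n) (≈⇒-≈0 m≈n))

  residue-cong : a ≈ b → residue a ≡ residue b
  residue-cong {a} {b} a≈b =
    ≈⇒≡ (residue<p a) (residue<p b) (≈-trans (residue-≈ a) (≈-trans a≈b (≈-sym (residue-≈ b))))

  residue-injective : residue a ≡ residue b → a ≈ b
  residue-injective {a} {b} eq =
    ≈-trans (≈-sym (residue-≈ a)) (≈-trans (≈-reflexive (cong +_ eq)) (residue-≈ b))

  residue-small : ∀ {n} → n < p → residue (+ n) ≡ n
  residue-small = ℕ%.m<n⇒m%n≡m


  ≉0-small : ∀ {n} → 0 < n → n < p → + n ≉ 0ℤ
  ≉0-small {suc n} _ n<p n≈0 with ≈⇒≡ n<p (ℕP.<-trans (s≤s z≤n) n<p) n≈0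
  ... | ()

  complement : ∀ {m n} → m ℕ.+ n ≡ p → + m ≈ - + n
  complement {m} {n} m+n≡p = ≈-by (ℤD∣.divides 1ℤ (begin
    + m - - + n   ≡⟨ cong₂ _+_ (refl {x = + m}) (ℤP.neg-involutive (+ n)) ⟩
    + m + + n     ≡⟨ ℤP.pos-+ m n ⟨
    + (m ℕ.+ n)   ≡⟨ cong +_ m+n≡p ⟩
    + p           ≡⟨ ℤP.*-identityˡ (+ p) ⟨
    1ℤ * + p      ∎)) refl
    where open ≡-Reasoning

  -1≉1 : 2 < p → - 1ℤ ≉ 1ℤ
  -1≉1 2<p -1≈1 = ≉0-small (s≤s z≤n) 2<p (+-cong (≈-refl {1ℤ}) (-‿cong -1≈1))

  infix 4 _≈±_

  _≈±_ : ℤ → ℤ → Set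
  a ≈± b = a ≈ b ⊎ a ≈ - b

  ≈±-sym : a ≈± b → b ≈± a
  ≈±-sym (inj₁ a≈b)  = inj₁ (≈-sym a≈b)
  ≈±-sym {a} {b} (inj₂ a≈-b) = inj₂ (≈-sym (≈-trans (-‿cong a≈-b) (≈-reflexive (ℤP.neg-involutive b))))

  ≈±-trans : a ≈± b → b ≈± c → a ≈± c
  ≈±-trans (inj₁ a≈b)  (inj₁ b≈c)  = inj₁ (≈-trans a≈b b≈c)
  ≈±-trans (inj₁ a≈b)  (inj₂ b≈-c) = inj₂ (≈-trans a≈b b≈-c)
  ≈±-trans (inj₂ a≈-b) (inj₁ b≈c)  = inj₂ (≈-trans a≈-b (-‿cong b≈c))
  ≈±-trans {c = c} (inj₂ a≈-b) (inj₂ b≈-c) =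
    inj₁ (≈-trans a≈-b (≈-trans (-‿cong b≈-c) (≈-reflexive (ℤP.neg-involutive c))))

  ≈±-*ʳ : ∀ c → a ≈± b → a * c ≈± b * c
  ≈±-*ʳ c (inj₁ a≈b)  = inj₁ (*-congʳ c a≈b)
  ≈±-*ʳ {b = b} c (inj₂ a≈-b) = inj₂ (≈-trans (*-congʳ c a≈-b) (≈-reflexive (sym (ℤP.neg-distribˡ-* b c))))

  -‿swap : ∀ {a b c} → b - a ≈ - c → a - b ≈ c
  -‿swap {a} {b} {c} b-a≈-c = begin
    a - b       ≡⟨ eq a b ⟩
    - (b - a)   ≈⟨ -‿cong b-a≈-c ⟩
    - - c       ≡⟨ ℤP.neg-involutive c ⟩
    c           ∎
    where
    open ≈-Reasoning
    eq : ∀ a b → a - b ≡ - (b - a)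
    eq = solve-∀

  -‿swap± : ∀ {a b c} → b - a ≈± c → a - b ≈± c
  -‿swap± {a} {b} {c} (inj₁ b-a≈c) = inj₂ (≈-trans (≈-reflexive (eq a b)) (-‿cong b-a≈c))
    where eq : ∀ a b → a - b ≡ - (b - a)
          eq = solve-∀
  -‿swap± {a} {b} (inj₂ b-a≈-c) = inj₁ (-‿swap {a} {b} b-a≈-c)

  ≈±0⇒≈0 : a ≈± 0ℤ → a ≈ 0ℤ
  ≈±0⇒≈0 = [ id , id ]′

  absResidue : ℤ → ℕ
  absResidue a = residue a ⊓ residue (- a)

  absResidue<p : ∀ a → absResidue a < p
  absResidue<p a = ℕP.≤-<-trans (ℕP.m⊓n≤m (residue a) (residue (- a))) (residue<p a)

  absResidue-≈± : ∀ a → + absResidue a ≈± a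
  absResidue-≈± a with ℕP.⊓-sel (residue a) (residue (- a))
  ... | inj₁ eq = inj₁ (≈-trans (≈-reflexive (cong +_ eq)) (residue-≈ a))
  ... | inj₂ eq = inj₂ (≈-trans (≈-reflexive (cong +_ eq)) (residue-≈ (- a)))

  absResidue-cong : a ≈± b → absResidue a ≡ absResidue b
  absResidue-cong (inj₁ a≈b) = cong₂ _⊓_ (residue-cong a≈b) (residue-cong (-‿cong a≈b))
  absResidue-cong {a} {b} (inj₂ a≈-b) = trans
    (cong₂ _⊓_ (residue-cong a≈-b) (residue-cong (≈-trans (-‿cong a≈-b) (≈-reflexive (ℤP.neg-involutive b)))))
    (ℕP.⊓-comm (residue (- b)) (residue b))

  absResidue>0 : a ≉ 0ℤ → 0 < absResidue a
  absResidue>0 {a} a≉0 = ℕP.n≢0⇒n>0 (λ abs≡0 →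
    a≉0 (≈±0⇒≈0 (≈±-trans (≈±-sym (absResidue-≈± a)) (inj₁ (≈-reflexive (cong +_ abs≡0))))))

  InBlock : ℤ → ℤ → Set
  InBlock d a = d ≈± a ⊎ d ≈± a * + 2

  InBlock-resp : a ≈± b → InBlock d a → InBlock d b
  InBlock-resp a≈±b (inj₁ d≈±a)  = inj₁ (≈±-trans d≈±a a≈±b)
  InBlock-resp a≈±b (inj₂ d≈±2a) = inj₂ (≈±-trans d≈±2a (≈±-*ʳ (+ 2) a≈±b))

  2^_ : ℕ → ℤ
  2^ e = (+ 2) ^ e

  2^-+ : ∀ m n → 2^ (m ℕ.+ n) ≡ 2^ m * 2^ n
  2^-+ = ℤP.^-distribˡ-+-* (+ 2)

  +[2^]≡2^ : ∀ e → + (2 ℕ.^ e) ≡ 2^ e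
  +[2^]≡2^ zero    = refl
  +[2^]≡2^ (suc e) = trans (ℤP.pos-* 2 (2 ℕ.^ e)) (cong (+ 2 *_) (+[2^]≡2^ e))

  +[2^∸1]+1≡2^ : ∀ e → + (2 ℕ.^ e ℕ.∸ 1) + 1ℤ ≡ 2^ e
  +[2^∸1]+1≡2^ e = trans (sym (ℤP.pos-+ (2 ℕ.^ e ℕ.∸ 1) 1))
                         (trans (cong +_ (ℕP.m∸n+n≡m (ℕP.m^n>0 2 e))) (+[2^]≡2^ e))

  ∣2^∸1⇒2^≈1 : ∀ e → p ∣ 2 ℕ.^ e ℕ.∸ 1 → 2^ e ≈ 1ℤ
  ∣2^∸1⇒2^≈1 e p∣ = begin
    2^ e                     ≡⟨ +[2^∸1]+1≡2^ e ⟨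
    + (2 ℕ.^ e ℕ.∸ 1) + 1ℤ   ≈⟨ +-cong (∣⇒≈0 (+ (2 ℕ.^ e ℕ.∸ 1)) p∣) (≈-refl {1ℤ}) ⟩
    1ℤ                       ∎
    where open ≈-Reasoning

  2^≈1⇒∣2^∸1 : ∀ e → 2^ e ≈ 1ℤ → p ∣ 2 ℕ.^ e ℕ.∸ 1
  2^≈1⇒∣2^∸1 e 2^e≈1 = ≈0⇒∣ (+ (2 ℕ.^ e ℕ.∸ 1)) (-≈0⇒≈ (begin
    + (2 ℕ.^ e ℕ.∸ 1) - 0ℤ          ≡⟨ eq (+ (2 ℕ.^ e ℕ.∸ 1)) ⟩
    (+ (2 ℕ.^ e ℕ.∸ 1) + 1ℤ) - 1ℤ   ≡⟨ cong (_- 1ℤ) (+[2^∸1]+1≡2^ e) ⟩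
    2^ e - 1ℤ                       ≈⟨ ≈⇒-≈0 2^e≈1 ⟩
    0ℤ                              ∎))
    where
    open ≈-Reasoning
    eq : ∀ a → a - 0ℤ ≡ (a + 1ℤ) - 1ℤ
    eq = solve-∀

  2^≈-1⇒2^[2n]≈1 : ∀ {n} → 2^ n ≈ - 1ℤ → 2^ (2 ℕ.* n) ≈ 1ℤ
  2^≈-1⇒2^[2n]≈1 {n} 2^n≈-1 = begin
    2^ (2 ℕ.* n)   ≡⟨ cong (λ m → 2^ (n ℕ.+ m)) (ℕP.+-identityʳ n) ⟩
    2^ (n ℕ.+ n)   ≡⟨ 2^-+ n n ⟩
    2^ n * 2^ n    ≈⟨ *-cong 2^n≈-1 2^n≈-1 ⟩
    1ℤ             ∎
    where open ≈-Reasoning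

  order-of-2-exists : ∀ {e} → 0 < e → 2^ e ≈ 1ℤ → ∃[ k ] IsOrderOf2Mod p k
  order-of-2-exists {e} 0<e 2^e≈1 with least-witness period? {e} (0<e , 2^≈1⇒∣2^∸1 e 2^e≈1)
    where
    period? : Decidable (λ e → 0 < e × p ∣ 2 ℕ.^ e ℕ.∸ 1)
    period? e = 0 ℕ.<? e ×-dec p ℕD.∣? 2 ℕ.^ e ℕ.∸ 1
  ... | k , (0<k , p∣) , minimal = k , 0<k , p∣ , λ j 0<j j<k p∣′ → minimal j<k (0<j , p∣′)

module PrimeModulus (p : ℕ) (p-prime : Prime p) where

  instance
    p≢0 : NonZero p
    p≢0 = prime⇒nonZero p-prime

  open Congruence p public

  private
    variable a b c : ℤ

  *-≈0 : a * b ≈ 0ℤ → a ≈ 0ℤ ⊎ b ≈ 0ℤ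
  *-≈0 {a} {b} ab≈0 = Sum.map (∣⇒≈0 a) (∣⇒≈0 b)
    (euclidsLemma ℤ.∣ a ∣ ℤ.∣ b ∣ p-prime (subst (p ∣_) (ℤP.abs-* a b) (≈0⇒∣ (a * b) ab≈0)))

  *-≉0 : a ≉ 0ℤ → b ≉ 0ℤ → a * b ≉ 0ℤ
  *-≉0 a≉0 b≉0 ab≈0 = [ a≉0 , b≉0 ]′ (*-≈0 ab≈0)

  *-cancelˡ : a ≉ 0ℤ → a * b ≈ a * c → b ≈ c
  *-cancelˡ {a} {b} {c} a≉0 ab≈ac =
    [ flip contradiction a≉0 , -≈0⇒≈ ]′ (*-≈0 (≈-trans (≈-reflexive (eq a b c)) (≈⇒-≈0 ab≈ac)))
    where eq : ∀ a b c → a * (b - c) ≡ a * b - a * c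
          eq = solve-∀

  square≈1 : a * a ≈ 1ℤ → a ≈ 1ℤ ⊎ a ≈ - 1ℤ
  square≈1 {a} a²≈1 = Sum.map -≈0⇒≈ -≈0⇒≈ (*-≈0 (≈-trans (≈-reflexive (eq a)) (≈⇒-≈0 a²≈1)))
    where eq : ∀ a → (a - 1ℤ) * (a - - 1ℤ) ≡ a * a - 1ℤ
          eq = solve-∀

  inverse : a ≉ 0ℤ → ∃[ b ] a * b ≈ 1ℤ
  inverse {a} a≉0 with residue a in r≡ | residue<p a
  ... | zero  | _   = contradiction (≈-trans (≈-sym (residue-≈ a)) (≈-reflexive (cong +_ r≡))) a≉0
  ... | suc r | r<p =
    map₂ (λ {b} → ≈-trans (*-congʳ b (≈-sym a≈r))) (inverse-small (coprime-Bézout (prime⇒coprime p-prime r<p)))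
    where
    a≈r : + suc r ≈ a
    a≈r = ≈-trans (≈-reflexive (cong +_ (sym r≡))) (residue-≈ a)
    pos-1+* : ∀ x y → + (1 ℕ.+ x ℕ.* y) ≡ 1ℤ + + x * + y
    pos-1+* x y = trans (ℤP.pos-+ 1 (x ℕ.* y)) (cong₂ _+_ (refl {x = 1ℤ}) (ℤP.pos-* x y))
    inverse-small : Bézout.Identity 1 p (suc r) → ∃[ b ] + suc r * b ≈ 1ℤ
    inverse-small (Bézout.+- x y eq) = - + y , ≈-sym (begin
      1ℤ                          ≈⟨ +-multiple 1ℤ (- + x) ⟨
      1ℤ + - + x * + p            ≡⟨ ring₁ (+ x) (+ p) ⟩
      1ℤ - + x * + p              ≡⟨ cong₂ _-_ (refl {x = 1ℤ}) x*p≡1+y*r ⟩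
      1ℤ - (1ℤ + + y * + suc r)   ≡⟨ ring₂ (+ y) (+ suc r) ⟩
      + suc r * - + y             ∎)
      where
      open ≈-Reasoning
      x*p≡1+y*r : + x * + p ≡ 1ℤ + + y * + suc r
      x*p≡1+y*r = trans (sym (ℤP.pos-* x p)) (trans (cong +_ (sym eq)) (pos-1+* y (suc r)))
      ring₁ : ∀ x p → 1ℤ + - x * p ≡ 1ℤ - x * p
      ring₁ = solve-∀
      ring₂ : ∀ y r → 1ℤ - (1ℤ + y * r) ≡ r * - y
      ring₂ = solve-∀
    inverse-small (Bézout.-+ x y eq) = + y , (begin
      + suc r * + y       ≡⟨ trans (ℤP.*-comm (+ suc r) (+ y)) (sym (ℤP.pos-* y (suc r))) ⟩
      + (y ℕ.* suc r)     ≡⟨ cong +_ (sym eq) ⟩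
      + (1 ℕ.+ x ℕ.* p)   ≡⟨ pos-1+* x p ⟩
      1ℤ + + x * + p      ≈⟨ +-multiple 1ℤ (+ x) ⟩
      1ℤ                  ∎)
      where open ≈-Reasoning

  1≉0 : 1ℤ ≉ 0ℤ
  1≉0 = ≉0-small (s≤s z≤n) (ℕ.nonTrivial⇒n>1 p {{prime⇒nonTrivial p-prime}})

  !≉0 : ∀ n → n < p → + (n !) ≉ 0ℤ
  !≉0 zero    _     = 1≉0
  !≉0 (suc n) 1+n<p = subst (_≉ 0ℤ) (sym (ℤP.pos-* (suc n) (n !)))
    (*-≉0 (≉0-small (s≤s z≤n) 1+n<p) (!≉0 n (ℕP.<-trans (ℕP.n<1+n n) 1+n<p)))

module OrderOfTwo (p : ℕ) (p-prime : Prime p) (k : ℕ) (order : IsOrderOf2Mod p k) where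

  open PrimeModulus p p-prime public

  instance
    k≢0 : NonZero k
    k≢0 = ℕ.>-nonZero (proj₁ order)

  private
    variable
      x : ℤ
      i j : ℕ

  2^k≈1 : 2^ k ≈ 1ℤ
  2^k≈1 = ∣2^∸1⇒2^≈1 k (proj₁ (proj₂ order))

  2^≈1⇒≡0 : i < k → 2^ i ≈ 1ℤ → i ≡ 0
  2^≈1⇒≡0 {zero}  _   _      = refl
  2^≈1⇒≡0 {suc i} i<k 2^i≈1 =
    contradiction (2^≈1⇒∣2^∸1 (suc i) 2^i≈1) (proj₂ (proj₂ order) (suc i) (s≤s z≤n) i<k)

  2^[q*k]≈1 : ∀ q → 2^ (q ℕ.* k) ≈ 1ℤ
  2^[q*k]≈1 zero    = ≈-refl
  2^[q*k]≈1 (suc q) = begin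
    2^ (k ℕ.+ q ℕ.* k)    ≡⟨ 2^-+ k (q ℕ.* k) ⟩
    2^ k * 2^ (q ℕ.* k)   ≈⟨ *-cong 2^k≈1 (2^[q*k]≈1 q) ⟩
    1ℤ                    ∎
    where open ≈-Reasoning

  k∣⇒2^≈1 : ∀ {e} → k ∣ e → 2^ e ≈ 1ℤ
  k∣⇒2^≈1 (divides q refl) = 2^[q*k]≈1 q

  2^-mod : ∀ e → 2^ e ≈ 2^ (e % k)
  2^-mod e = begin
    2^ e                            ≡⟨ cong 2^_ (ℕ%.m≡m%n+[m/n]*n e k) ⟩
    2^ (e % k ℕ.+ e / k ℕ.* k)      ≡⟨ 2^-+ (e % k) (e / k ℕ.* k) ⟩
    2^ (e % k) * 2^ (e / k ℕ.* k)   ≈⟨ *-congˡ (2^ (e % k)) (2^[q*k]≈1 (e / k)) ⟩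
    2^ (e % k) * 1ℤ                 ≡⟨ ℤP.*-identityʳ (2^ (e % k)) ⟩
    2^ (e % k)                      ∎
    where open ≈-Reasoning

  2^≈1⇒k∣ : ∀ e → 2^ e ≈ 1ℤ → k ∣ e
  2^≈1⇒k∣ e 2^e≈1 = ℕD.m%n≡0⇒n∣m e k (2^≈1⇒≡0 (ℕ%.m%n<n e k) (≈-trans (≈-sym (2^-mod e)) 2^e≈1))

  2^-inverse : ∀ s → 2^ s * 2^ (s ℕ.* ℕ.pred k) ≈ 1ℤ
  2^-inverse s = begin
    2^ s * 2^ (s ℕ.* ℕ.pred k)   ≡⟨ 2^-+ s (s ℕ.* ℕ.pred k) ⟨
    2^ (s ℕ.+ s ℕ.* ℕ.pred k)    ≡⟨ cong 2^_ (ℕP.*-suc s (ℕ.pred k)) ⟨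
    2^ (s ℕ.* suc (ℕ.pred k))    ≡⟨ cong (λ n → 2^ (s ℕ.* n)) (ℕP.suc-pred k) ⟩
    2^ (s ℕ.* k)                 ≈⟨ 2^[q*k]≈1 s ⟩
    1ℤ                           ∎
    where open ≈-Reasoning

  2^≉0 : ∀ s → 2^ s ≉ 0ℤ
  2^≉0 s 2^s≈0 = 1≉0 (begin
    1ℤ                           ≈⟨ 2^-inverse s ⟨
    2^ s * 2^ (s ℕ.* ℕ.pred k)   ≈⟨ *-congʳ (2^ (s ℕ.* ℕ.pred k)) 2^s≈0 ⟩
    0ℤ * 2^ (s ℕ.* ℕ.pred k)     ≡⟨ ℤP.*-zeroˡ (2^ (s ℕ.* ℕ.pred k)) ⟩
    0ℤ                           ∎)
    where open ≈-Reasoning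

  2^-injective-≤ : i ≤ j → j < k → 2^ i ≈ 2^ j → i ≡ j
  2^-injective-≤ {i} {j} i≤j j<k 2^i≈2^j = ℕP.≤-antisym i≤j (ℕP.m∸n≡0⇒m≤n j∸i≡0)
    where
    open ≈-Reasoning
    2^[j∸i]≈1 : 2^ (j ℕ.∸ i) ≈ 1ℤ
    2^[j∸i]≈1 = ≈-sym (*-cancelˡ (2^≉0 i) (begin
      2^ i * 1ℤ              ≡⟨ ℤP.*-identityʳ (2^ i) ⟩
      2^ i                   ≈⟨ 2^i≈2^j ⟩
      2^ j                   ≡⟨ cong 2^_ (ℕP.m+[n∸m]≡n i≤j) ⟨
      2^ (i ℕ.+ (j ℕ.∸ i))   ≡⟨ 2^-+ i (j ℕ.∸ i) ⟩
      2^ i * 2^ (j ℕ.∸ i)    ∎))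
    j∸i≡0 : j ℕ.∸ i ≡ 0
    j∸i≡0 = 2^≈1⇒≡0 (ℕP.≤-<-trans (ℕP.m∸n≤m j i) j<k) 2^[j∸i]≈1

  2^-injective : x ≉ 0ℤ → i < k → j < k → x * 2^ i ≈ x * 2^ j → i ≡ j
  2^-injective {i = i} {j} x≉0 i<k j<k x2^i≈x2^j with ℕP.≤-total i j
  ... | inj₁ i≤j = 2^-injective-≤ i≤j j<k (*-cancelˡ x≉0 x2^i≈x2^j)
  ... | inj₂ j≤i = sym (2^-injective-≤ j≤i i<k (≈-sym (*-cancelˡ x≉0 x2^i≈x2^j)))

  2^≈-1⇒4∣k : 2 < p → ∀ {n} → 2 ∣ n → 2^ n ≈ - 1ℤ → 4 ∣ k
  2^≈-1⇒4∣k 2<p {n} 2∣n 2^n≈-1 = 4∣-of-halving (2^≈1⇒k∣ (2 ℕ.* n) (2^≈-1⇒2^[2n]≈1 {n} 2^n≈-1)) k∤n 2∣n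
    where
    k∤n : ¬ k ∣ n
    k∤n k∣n = -1≉1 2<p (≈-trans (≈-sym 2^n≈-1) (k∣⇒2^≈1 k∣n))

module GaussLemmaForTwo (p : ℕ) (p-prime : Prime p) (c : ℕ) (p≡4c+1 : p ≡ 4 ℕ.* c ℕ.+ 1) where

  open PrimeModulus p p-prime

  upperEvens : ℕ → ℕ
  upperEvens m = prod m (λ i → 2 ℕ.* (c ℕ.+ i) ℕ.+ 2)

  pair-sum≡p : ∀ m e → suc (m ℕ.+ e) ≡ c → 2 ℕ.* (c ℕ.+ m) ℕ.+ 2 ℕ.+ (2 ℕ.* e ℕ.+ 1) ≡ p
  pair-sum≡p m e 1+m+e≡c = begin
    2 ℕ.* (c ℕ.+ m) ℕ.+ 2 ℕ.+ (2 ℕ.* e ℕ.+ 1)   ≡⟨ eq₁ c m e ⟩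
    2 ℕ.* c ℕ.+ 2 ℕ.* suc (m ℕ.+ e) ℕ.+ 1       ≡⟨ cong (λ n → 2 ℕ.* c ℕ.+ 2 ℕ.* n ℕ.+ 1) 1+m+e≡c ⟩
    2 ℕ.* c ℕ.+ 2 ℕ.* c ℕ.+ 1                   ≡⟨ eq₂ c ⟩
    4 ℕ.* c ℕ.+ 1                               ≡⟨ p≡4c+1 ⟨
    p                                           ∎
    where
    open ≡-Reasoning
    eq₁ : ∀ c m e → 2 ℕ.* (c ℕ.+ m) ℕ.+ 2 ℕ.+ (2 ℕ.* e ℕ.+ 1) ≡ 2 ℕ.* c ℕ.+ 2 ℕ.* suc (m ℕ.+ e) ℕ.+ 1
    eq₁ = ℕSolver.solve-∀
    eq₂ : ∀ c → 2 ℕ.* c ℕ.+ 2 ℕ.* c ℕ.+ 1 ≡ 4 ℕ.* c ℕ.+ 1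
    eq₂ = ℕSolver.solve-∀

  upperEvens*odds : ∀ m e → m ℕ.+ e ≡ c → + (upperEvens m ℕ.* odds e) ≈ (- 1ℤ) ^ m * + odds c
  upperEvens*odds zero    e e≡c = ≈-reflexive (begin
    + (1 ℕ.* odds e)   ≡⟨ cong +_ (ℕP.*-identityˡ (odds e)) ⟩
    + odds e           ≡⟨ cong (λ n → + odds n) e≡c ⟩
    + odds c           ≡⟨ ℤP.*-identityˡ (+ odds c) ⟨
    1ℤ * + odds c      ∎)
    where open ≡-Reasoning
  upperEvens*odds (suc m) e 1+m+e≡c = begin
    + (U ℕ.* A ℕ.* O)           ≡⟨ pos-*₃ U A O ⟩
    + U * + A * + O             ≈⟨ *-congʳ (+ O) (*-congˡ (+ U) (complement (pair-sum≡p m e 1+m+e≡c))) ⟩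
    + U * - + B * + O           ≡⟨ eq (+ U) (+ B) (+ O) ⟩
    - (+ U * (+ O * + B))       ≡⟨ cong (λ x → - (+ U * x)) (ℤP.pos-* O B) ⟨
    - (+ U * + (O ℕ.* B))       ≡⟨ cong -_ (ℤP.pos-* U (O ℕ.* B)) ⟨
    - + (U ℕ.* odds (suc e))    ≈⟨ -‿cong (upperEvens*odds m (suc e) (trans (ℕP.+-suc m e) 1+m+e≡c)) ⟩
    - ((- 1ℤ) ^ m * + odds c)   ≡⟨ ℤP.neg-distribˡ-* ((- 1ℤ) ^ m) (+ odds c) ⟩
    - ((- 1ℤ) ^ m) * + odds c   ≡⟨ cong (_* + odds c) (ℤP.-1*i≡-i ((- 1ℤ) ^ m)) ⟨
    (- 1ℤ) ^ suc m * + odds c   ∎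
    where
    open ≈-Reasoning
    U = upperEvens m
    A = 2 ℕ.* (c ℕ.+ m) ℕ.+ 2
    B = 2 ℕ.* e ℕ.+ 1
    O = odds e
    pos-*₃ : ∀ x y z → + (x ℕ.* y ℕ.* z) ≡ + x * + y * + z
    pos-*₃ x y z = trans (ℤP.pos-* (x ℕ.* y) z) (cong (_* + z) (ℤP.pos-* x y))
    eq : ∀ u b o → u * - b * o ≡ - (u * (o * b))
    eq = solve-∀

  c+c<p : c ℕ.+ c < p
  c+c<p = subst (c ℕ.+ c <_) (trans (ℕP.+-comm 1 (4 ℕ.* c)) (sym p≡4c+1))
    (s≤s (ℕP.+-monoʳ-≤ c (ℕP.m≤m+n c (c ℕ.+ (c ℕ.+ 0)))))

  -- Gauss's lemma: 2^N N! = 2·4···2N with N = 2c, and modulo p = 2N + 1 the c factors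
  -- above N are the negatives of the odd numbers below N.
  2^[c+c]≈[-1]^c : 2^ (c ℕ.+ c) ≈ (- 1ℤ) ^ c
  2^[c+c]≈[-1]^c = *-cancelˡ (!≉0 N c+c<p) (begin
    F * 2^ N                                    ≡⟨ ℤP.*-comm F (2^ N) ⟩
    2^ N * F                                    ≡⟨ cong (_* F) (+[2^]≡2^ N) ⟨
    + (2 ℕ.^ N) * F                             ≡⟨ ℤP.pos-* (2 ℕ.^ N) (N !) ⟨
    + (2 ℕ.^ N ℕ.* N !)                         ≡⟨ cong +_ (evens≡2^*! N) ⟨
    + evens N                                   ≡⟨ cong +_ (prod-+ c c (λ i → 2 ℕ.* i ℕ.+ 2)) ⟩
    + (evens c ℕ.* upperEvens c)                ≡⟨ cong (λ x → + (evens c ℕ.* x)) (ℕP.*-identityʳ (upperEvens c)) ⟨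
    + (evens c ℕ.* (upperEvens c ℕ.* odds 0))   ≡⟨ ℤP.pos-* (evens c) _ ⟩
    + evens c * + (upperEvens c ℕ.* odds 0)     ≈⟨ *-congˡ (+ evens c) (upperEvens*odds c 0 (ℕP.+-identityʳ c)) ⟩
    + evens c * ((- 1ℤ) ^ c * + odds c)         ≡⟨ eq (+ evens c) ((- 1ℤ) ^ c) (+ odds c) ⟩
    (- 1ℤ) ^ c * (+ evens c * + odds c)         ≡⟨ cong ((- 1ℤ) ^ c *_) (ℤP.pos-* (evens c) (odds c)) ⟨
    (- 1ℤ) ^ c * + (evens c ℕ.* odds c)         ≡⟨ cong (λ x → (- 1ℤ) ^ c * + x) ([n+n]!≡evens*odds c) ⟨
    (- 1ℤ) ^ c * F                              ≡⟨ ℤP.*-comm ((- 1ℤ) ^ c) F ⟩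
    F * (- 1ℤ) ^ c                              ∎)
    where
    open ≈-Reasoning
    N = c ℕ.+ c
    F = + (N !)
    eq : ∀ e s o → e * (s * o) ≡ s * (e * o)
    eq = solve-∀

module OrbitPosition (p : ℕ) (p-prime : Prime p) (k : ℕ) (order : IsOrderOf2Mod p k) (2∣k : 2 ∣ k) where

  open OrderOfTwo p p-prime k order public

  parity-k : parity k ≡ 0ℙ
  parity-k = trans (cong parity (ℕD._∣_.equality 2∣k)) (trans (ℙP.*-homo-* t 2) (ℙP.*-zeroʳ (parity t)))
    where t = ℕD._∣_.quotient 2∣k

  parity-*k : ∀ q → parity (q ℕ.* k) ≡ 0ℙ
  parity-*k q = trans (ℙP.*-homo-* q k) (trans (cong (parity q ℙ.*_) parity-k) (ℙP.*-zeroʳ (parity q)))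

  parity-% : ∀ n → parity (n % k) ≡ parity n
  parity-% n = sym (begin
    parity n                                  ≡⟨ cong parity (ℕ%.m≡m%n+[m/n]*n n k) ⟩
    parity (n % k ℕ.+ n / k ℕ.* k)            ≡⟨ ℙP.+-homo-+ (n % k) (n / k ℕ.* k) ⟩
    parity (n % k) ℙ.+ parity (n / k ℕ.* k)   ≡⟨ cong (parity (n % k) ℙ.+_) (parity-*k (n / k)) ⟩
    parity (n % k) ℙ.+ 0ℙ                     ≡⟨ ℙP.+-identityʳ (parity (n % k)) ⟩
    parity (n % k)                            ∎)
    where open ≡-Reasoning

  orbitResidue : ℤ → ℕ → ℕ
  orbitResidue x j = residue (x * 2^ j)

  -- minExp x doublings carry x to the least residue of its coset x⟨2⟩; the parity of minExp x
  -- is the parity of the position of x in that coset.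
  minExp : ℤ → ℕ
  minExp x = argmin (orbitResidue x) 0 (upTo k)

  minExp<k : ∀ x → minExp x < k
  minExp<k x = argmin-all (orbitResidue x) (ℕ.>-nonZero⁻¹ k) (applyUpTo⁺₁ id k id)

  minExp-minimal : ∀ x j → residue (x * 2^ minExp x) ≤ residue (x * 2^ j)
  minExp-minimal x j = subst (residue (x * 2^ minExp x) ≤_) (residue-cong (*-congˡ x (≈-sym (2^-mod j))))
    (applyUpTo⁻ id k (f[argmin]≤f[xs] {f = orbitResidue x} 0 (upTo k)) (ℕ%.m%n<n j k))

  *2^-+ : ∀ x m n → x * 2^ (m ℕ.+ n) ≡ x * 2^ m * 2^ n
  *2^-+ x m n = trans (cong (x *_) (2^-+ m n)) (sym (ℤP.*-assoc x (2^ m) (2^ n)))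

  orbitMin-shift : ∀ {x y s} → y ≈ x * 2^ s → residue (x * 2^ minExp x) ≡ residue (y * 2^ minExp y)
  orbitMin-shift {x} {y} {s} y≈x2^s = ℕP.≤-antisym
    (subst (residue (x * 2^ minExp x) ≤_) (residue-cong x2^[s+my]≈y2^my) (minExp-minimal x (s ℕ.+ minExp y)))
    (subst (residue (y * 2^ minExp y) ≤_) (residue-cong y2^[t+mx]≈x2^mx) (minExp-minimal y (t ℕ.+ minExp x)))
    where
    open ≈-Reasoning
    t = s ℕ.* ℕ.pred k
    x2^[s+my]≈y2^my : x * 2^ (s ℕ.+ minExp y) ≈ y * 2^ minExp y
    x2^[s+my]≈y2^my = begin
      x * 2^ (s ℕ.+ minExp y)   ≡⟨ *2^-+ x s (minExp y) ⟩
      x * 2^ s * 2^ minExp y    ≈⟨ *-congʳ (2^ minExp y) y≈x2^s ⟨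
      y * 2^ minExp y           ∎
    y2^[t+mx]≈x2^mx : y * 2^ (t ℕ.+ minExp x) ≈ x * 2^ minExp x
    y2^[t+mx]≈x2^mx = begin
      y * 2^ (t ℕ.+ minExp x)           ≡⟨ *2^-+ y t (minExp x) ⟩
      y * 2^ t * 2^ minExp x            ≈⟨ *-congʳ (2^ minExp x) (*-congʳ (2^ t) y≈x2^s) ⟩
      x * 2^ s * 2^ t * 2^ minExp x     ≡⟨ cong (_* 2^ minExp x) (ℤP.*-assoc x (2^ s) (2^ t)) ⟩
      x * (2^ s * 2^ t) * 2^ minExp x   ≈⟨ *-congʳ (2^ minExp x) (*-congˡ x (2^-inverse s)) ⟩
      x * 1ℤ * 2^ minExp x              ≡⟨ cong (_* 2^ minExp x) (ℤP.*-identityʳ x) ⟩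
      x * 2^ minExp x                   ∎

  minExp-shift : ∀ {x y s} → x ≉ 0ℤ → y ≈ x * 2^ s → minExp x ≡ (s ℕ.+ minExp y) % k
  minExp-shift {x} {y} {s} x≉0 y≈x2^s = 2^-injective x≉0 (minExp<k x) (ℕ%.m%n<n (s ℕ.+ minExp y) k) (begin
    x * 2^ minExp x                 ≈⟨ residue-injective (orbitMin-shift {x} {y} {s} y≈x2^s) ⟩
    y * 2^ minExp y                 ≈⟨ *-congʳ (2^ minExp y) y≈x2^s ⟩
    x * 2^ s * 2^ minExp y          ≡⟨ *2^-+ x s (minExp y) ⟨
    x * 2^ (s ℕ.+ minExp y)         ≈⟨ *-congˡ x (2^-mod (s ℕ.+ minExp y)) ⟩
    x * 2^ ((s ℕ.+ minExp y) % k)   ∎)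
    where open ≈-Reasoning

  par : ℤ → Parity
  par x = parity (minExp x)

  par-shift : ∀ {x y s} → x ≉ 0ℤ → y ≈ x * 2^ s → par y ≡ parity s ℙ.+ par x
  par-shift {x} {y} {s} x≉0 y≈x2^s = begin
    par y                                        ≡⟨ cong (ℙ._+ par y) (ℙP.p+p≡0ℙ (parity s)) ⟨
    parity s ℙ.+ parity s ℙ.+ par y              ≡⟨ ℙP.+-assoc (parity s) (parity s) (par y) ⟩
    parity s ℙ.+ (parity s ℙ.+ par y)            ≡⟨ cong (parity s ℙ.+_) (ℙP.+-homo-+ s (minExp y)) ⟨
    parity s ℙ.+ parity (s ℕ.+ minExp y)         ≡⟨ cong (parity s ℙ.+_) (parity-% (s ℕ.+ minExp y)) ⟨
    parity s ℙ.+ parity ((s ℕ.+ minExp y) % k)   ≡⟨ cong (λ n → parity s ℙ.+ parity n) minExp-x ⟨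
    parity s ℙ.+ par x                           ∎
    where
    open ≡-Reasoning
    minExp-x = minExp-shift {x} {y} {s} x≉0 y≈x2^s

module CanonicalRepresentative (p : ℕ) (p-prime : Prime p) (k : ℕ) (order : IsOrderOf2Mod p k) (4∣k : 4 ∣ k) where

  open OrbitPosition p p-prime k order (ℕD.∣-trans (divides 2 refl) 4∣k) public

  private
    variable a d x y : ℤ
    t = ℕD._∣_.quotient 4∣k

  h : ℕ
  h = t ℕ.* 2

  k≡h+h : k ≡ h ℕ.+ h
  k≡h+h = trans (ℕD._∣_.equality 4∣k) (ℕP.*-distribˡ-+ t 2 2)

  parity-h : parity h ≡ 0ℙ
  parity-h = trans (ℙP.*-homo-* t 2) (ℙP.*-zeroʳ (parity t))

  0<h : 0 < h
  0<h = ℕP.n≢0⇒n>0 (λ h≡0 → ℕP.<⇒≢ (ℕ.>-nonZero⁻¹ k) (sym (trans k≡h+h (cong₂ ℕ._+_ h≡0 h≡0))))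

  h<k : h < k
  h<k = subst (h <_) (sym k≡h+h) (ℕP.m<m+n h 0<h)

  2^h≈-1 : 2^ h ≈ - 1ℤ
  2^h≈-1 = [ (λ 2^h≈1 → contradiction (2^≈1⇒≡0 h<k 2^h≈1) (ℕP.>⇒≢ 0<h)) , id ]′
    (square≈1 (begin
      2^ h * 2^ h    ≡⟨ 2^-+ h h ⟨
      2^ (h ℕ.+ h)   ≡⟨ cong 2^_ k≡h+h ⟨
      2^ k           ≈⟨ 2^k≈1 ⟩
      1ℤ             ∎))
    where open ≈-Reasoning

  par-± : x ≉ 0ℤ → y ≈± x → par y ≡ par x
  par-± {x} x≉0 (inj₁ y≈x)  = par-shift {s = 0} x≉0 (≈-trans y≈x (≈-reflexive (sym (ℤP.*-identityʳ x))))
  par-± {x} x≉0 (inj₂ y≈-x) = trans (par-shift {s = h} x≉0 (begin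
    _          ≈⟨ y≈-x ⟩
    - x        ≡⟨ ℤP.-1*i≡-i x ⟨
    - 1ℤ * x   ≡⟨ ℤP.*-comm (- 1ℤ) x ⟩
    x * - 1ℤ   ≈⟨ *-congˡ x 2^h≈-1 ⟨
    x * 2^ h   ∎)) (cong (ℙ._+ par x) parity-h)
    where open ≈-Reasoning

  halvingExp : Parity → ℕ
  halvingExp 0ℙ = 0
  halvingExp 1ℙ = ℕ.pred k

  parity-halvingExp : ∀ π → parity (halvingExp π) ≡ π
  parity-halvingExp 0ℙ = refl
  parity-halvingExp 1ℙ = begin
    parity (ℕ.pred k)              ≡⟨ ℙP.suc-homo-⁻¹ (ℕ.pred k) ⟨
    parity (suc (ℕ.pred k)) ℙ.⁻¹   ≡⟨ cong (λ n → parity n ℙ.⁻¹) (ℕP.suc-pred k) ⟩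
    parity k ℙ.⁻¹                  ≡⟨ cong ℙ._⁻¹ parity-k ⟩
    1ℙ                             ∎
    where open ≡-Reasoning

  2*2^[k-1]≈1 : + 2 * 2^ ℕ.pred k ≈ 1ℤ
  2*2^[k-1]≈1 = subst (λ n → 2^ n ≈ 1ℤ) (sym (ℕP.suc-pred k)) 2^k≈1

  *2*2^[k-1]≈id : ∀ x → x * + 2 * 2^ ℕ.pred k ≈ x
  *2*2^[k-1]≈id x = begin
    x * + 2 * 2^ ℕ.pred k     ≡⟨ ℤP.*-assoc x (+ 2) (2^ ℕ.pred k) ⟩
    x * (+ 2 * 2^ ℕ.pred k)   ≈⟨ *-congˡ x 2*2^[k-1]≈1 ⟩
    x * 1ℤ                    ≡⟨ ℤP.*-identityʳ x ⟩
    x                         ∎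
    where open ≈-Reasoning

  InBlock-halving : ∀ x π → InBlock x (x * 2^ halvingExp π)
  InBlock-halving x 0ℙ = inj₁ (inj₁ (≈-reflexive (sym (ℤP.*-identityʳ x))))
  InBlock-halving x 1ℙ = inj₂ (inj₁ (≈-sym (begin
    x * 2^ ℕ.pred k * + 2     ≡⟨ ℤP.*-assoc x (2^ ℕ.pred k) (+ 2) ⟩
    x * (2^ ℕ.pred k * + 2)   ≡⟨ cong (x *_) (ℤP.*-comm (2^ ℕ.pred k) (+ 2)) ⟩
    x * (+ 2 * 2^ ℕ.pred k)   ≡⟨ ℤP.*-assoc x (+ 2) (2^ ℕ.pred k) ⟨
    x * + 2 * 2^ ℕ.pred k     ≈⟨ *2*2^[k-1]≈id x ⟩
    x                         ∎)))
    where open ≈-Reasoning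

  -- Multiplying by 2^(k−1) halves, so evenPart x is whichever of x and x/2 lies at an even position.
  evenPart : ℤ → ℤ
  evenPart x = x * 2^ halvingExp (par x)

  evenPart-≉0 : x ≉ 0ℤ → evenPart x ≉ 0ℤ
  evenPart-≉0 {x} x≉0 = *-≉0 x≉0 (2^≉0 (halvingExp (par x)))

  par-evenPart : x ≉ 0ℤ → par (evenPart x) ≡ 0ℙ
  par-evenPart {x} x≉0 = begin
    par (evenPart x)                        ≡⟨ par-shift {s = halvingExp (par x)} x≉0 ≈-refl ⟩
    parity (halvingExp (par x)) ℙ.+ par x   ≡⟨ cong (ℙ._+ par x) (parity-halvingExp (par x)) ⟩
    par x ℙ.+ par x                         ≡⟨ ℙP.p+p≡0ℙ (par x) ⟩
    0ℙ                                      ∎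
    where open ≡-Reasoning

  evenPart-block : a ≉ 0ℤ → par a ≡ 0ℙ → InBlock d a → evenPart d ≈± a
  evenPart-block {a} {d} a≉0 par-a (inj₁ d≈±a) =
    subst (λ π → d * 2^ halvingExp π ≈± a) (sym (trans (par-± a≉0 d≈±a) par-a))
      (≈±-trans (inj₁ (≈-reflexive (ℤP.*-identityʳ d))) d≈±a)
  evenPart-block {a} {d} a≉0 par-a (inj₂ d≈±2a) =
    subst (λ π → d * 2^ halvingExp π ≈± a) (sym par-d)
      (≈±-trans (≈±-*ʳ (2^ ℕ.pred k) d≈±2a) (inj₁ (*2*2^[k-1]≈id a)))
    where
    par-d : par d ≡ 1ℙ
    par-d = begin
      par d           ≡⟨ par-± (*-≉0 a≉0 (2^≉0 1)) d≈±2a ⟩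
      par (a * + 2)   ≡⟨ par-shift {s = 1} a≉0 ≈-refl ⟩
      1ℙ ℙ.+ par a    ≡⟨ cong (1ℙ ℙ.+_) par-a ⟩
      1ℙ              ∎
      where open ≡-Reasoning

  -- The block {±e, ±2e} of d, where e = evenPart d, is named by the least absolute residue of e.
  representative : ℤ → ℕ
  representative d = absResidue (evenPart d)

  Canonical : ℕ → Set
  Canonical a = 0 < a × representative (+ a) ≡ a

  canonical? : Decidable Canonical
  canonical? a = 0 ℕ.<? a ×-dec representative (+ a) ℕ.≟ a

  representative<p : ∀ d → representative d < p
  representative<p d = absResidue<p (evenPart d)

  representative-block : a ≉ 0ℤ → par a ≡ 0ℙ → InBlock d a → representative d ≡ absResidue a
  representative-block a≉0 par-a d∈a = absResidue-cong (evenPart-block a≉0 par-a d∈a)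

  InBlock-representative : ∀ d → InBlock d (+ representative d)
  InBlock-representative d = InBlock-resp (≈±-sym (absResidue-≈± (evenPart d))) (InBlock-halving d (par d))

  representative-canonical : d ≉ 0ℤ → Canonical (representative d)
  representative-canonical {d} d≉0 =
    absResidue>0 (evenPart-≉0 d≉0) ,
    representative-block (evenPart-≉0 d≉0) (par-evenPart d≉0) (inj₁ (absResidue-≈± (evenPart d)))

  canonical≉0 : ∀ {a} → Canonical a → + a ≉ 0ℤ
  canonical≉0 {a} (0<a , rep≡a) = ≉0-small 0<a (subst (_< p) rep≡a (representative<p (+ a)))

  representative-unique : ∀ {a} → Canonical a → InBlock d (+ a) → representative d ≡ a
  representative-unique {d} {a} ca@(0<a , rep≡a) d∈a = begin
    representative d       ≡⟨ representative-block a≉0 par-a d∈a ⟩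
    absResidue (+ a)       ≡⟨ absResidue-cong a≈±e ⟩
    representative (+ a)   ≡⟨ rep≡a ⟩
    a                      ∎
    where
    open ≡-Reasoning
    a≉0 = canonical≉0 ca
    a≈±e : + a ≈± evenPart (+ a)
    a≈±e = subst (λ n → + n ≈± evenPart (+ a)) rep≡a (absResidue-≈± (evenPart (+ a)))
    par-a : par (+ a) ≡ 0ℙ
    par-a = trans (par-± (evenPart-≉0 a≉0) a≈±e) (par-evenPart a≉0)

module MultiplierCopy (p : ℕ) (p-prime : Prime p) where

  open PrimeModulus p p-prime public

  private
    variable
      a : ℤ
      i j : Fin p

  ⟦_⟧ : Fin p → ℤ
  ⟦ i ⟧ = + toℕ i

  ⟦⟧-injective : ⟦ i ⟧ ≈ ⟦ j ⟧ → i ≡ j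
  ⟦⟧-injective {i} {j} eq = FinP.toℕ-injective (≈⇒≡ (FinP.toℕ<n i) (FinP.toℕ<n j) eq)

  scale : ℤ → Fin p → Fin p
  scale a i = fromℕ< (residue<p (a * ⟦ i ⟧))

  ⟦scale⟧ : ∀ a i → ⟦ scale a i ⟧ ≈ a * ⟦ i ⟧
  ⟦scale⟧ a i = ≈-trans (≈-reflexive (cong +_ (FinP.toℕ-fromℕ< _))) (residue-≈ (a * ⟦ i ⟧))

  scale-injective : a ≉ 0ℤ → Injective _≡_ _≡_ (scale a)
  scale-injective {a} a≉0 {i} {j} eq = ⟦⟧-injective (*-cancelˡ a≉0
    (≈-trans (≈-sym (⟦scale⟧ a i)) (≈-trans (≈-reflexive (cong ⟦_⟧ eq)) (⟦scale⟧ a j))))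

  scale-inverse : ∀ {a b} → a * b ≈ 1ℤ → ∀ u → scale a (scale b u) ≡ u
  scale-inverse {a} {b} ab≈1 u = ⟦⟧-injective (begin
    ⟦ scale a (scale b u) ⟧   ≈⟨ ⟦scale⟧ a (scale b u) ⟩
    a * ⟦ scale b u ⟧         ≈⟨ *-congˡ a (⟦scale⟧ b u) ⟩
    a * (b * ⟦ u ⟧)           ≡⟨ ℤP.*-assoc a b ⟦ u ⟧ ⟨
    a * b * ⟦ u ⟧             ≈⟨ *-congʳ ⟦ u ⟧ ab≈1 ⟩
    1ℤ * ⟦ u ⟧                ≡⟨ ℤP.*-identityˡ ⟦ u ⟧ ⟩
    ⟦ u ⟧                     ∎)
    where open ≈-Reasoning

  multiplierCopy : a ≉ 0ℤ → SquareCycle p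
  multiplierCopy {a} a≉0 = sqcyc (scale a) (scale-injective a≉0)

  StepMod⇒≈ : ∀ {δ i j} → StepMod p δ i j → ⟦ j ⟧ ≈ ⟦ i ⟧ + + δ
  StepMod⇒≈ {δ} {i} {j} (inj₁ j≡i+δ)   = ≈-reflexive (trans (cong +_ j≡i+δ) (ℤP.pos-+ (toℕ i) δ))
  StepMod⇒≈ {δ} {i} {j} (inj₂ j+p≡i+δ) = begin
    ⟦ j ⟧              ≈⟨ +-multiple ⟦ j ⟧ 1ℤ ⟨
    ⟦ j ⟧ + 1ℤ * + p   ≡⟨ cong₂ _+_ (refl {x = ⟦ j ⟧}) (ℤP.*-identityˡ (+ p)) ⟩
    ⟦ j ⟧ + + p        ≡⟨ ℤP.pos-+ (toℕ j) p ⟨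
    + (toℕ j ℕ.+ p)    ≡⟨ cong +_ j+p≡i+δ ⟩
    + (toℕ i ℕ.+ δ)    ≡⟨ ℤP.pos-+ (toℕ i) δ ⟩
    ⟦ i ⟧ + + δ        ∎
    where open ≈-Reasoning

  ≈⇒StepMod : ∀ {δ i j} → δ < p → ⟦ j ⟧ ≈ ⟦ i ⟧ + + δ → StepMod p δ i j
  ≈⇒StepMod {δ} {i} {j} δ<p j≈i+δ =
    Sum.map (trans j≡[i+δ]%p) (trans (cong (ℕ._+ p) j≡[i+δ]%p)) (%-wrap (ℕP.+-mono-< (FinP.toℕ<n i) δ<p))
    where
    j≡[i+δ]%p : toℕ j ≡ (toℕ i ℕ.+ δ) % p
    j≡[i+δ]%p = trans (sym (residue-small (FinP.toℕ<n j)))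
      (residue-cong (≈-trans j≈i+δ (≈-reflexive (sym (ℤP.pos-+ (toℕ i) δ)))))

  Oriented : ℤ → (i j u v : Fin p) → Set
  Oriented a i j u v = (scale a i ≡ u × scale a j ≡ v) ⊎ (scale a i ≡ v × scale a j ≡ u)

  scaled-step : ∀ {δ i j} a → StepMod p δ i j → ⟦ scale a j ⟧ - ⟦ scale a i ⟧ ≈ a * + δ
  scaled-step {δ} {i} {j} a step = begin
    ⟦ scale a j ⟧ - ⟦ scale a i ⟧   ≈⟨ +-cong (⟦scale⟧ a j) (-‿cong (⟦scale⟧ a i)) ⟩
    a * ⟦ j ⟧ - a * ⟦ i ⟧           ≈⟨ +-cong (*-congˡ a (StepMod⇒≈ {δ} {i} {j} step)) (≈-refl { - (a * ⟦ i ⟧)}) ⟩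
    a * (⟦ i ⟧ + + δ) - a * ⟦ i ⟧   ≡⟨ eq a ⟦ i ⟧ (+ δ) ⟩
    a * + δ                         ∎
    where
    open ≈-Reasoning
    eq : ∀ a i δ → a * (i + δ) - a * i ≡ a * δ
    eq = solve-∀

  step-difference : ∀ {δ i j u v} a → StepMod p δ i j → Oriented a i j u v → ⟦ v ⟧ - ⟦ u ⟧ ≈± a * + δ
  step-difference a step (inj₁ (refl , refl)) = inj₁ (scaled-step a step)
  step-difference {i = i} {j} a step (inj₂ (refl , refl)) =
    -‿swap± {⟦ scale a i ⟧} {⟦ scale a j ⟧} (inj₁ (scaled-step a step))

  edge⇒block : ∀ {a u v} (a≉0 : a ≉ 0ℤ) → EdgeIn (multiplierCopy a≉0) u v → InBlock (⟦ v ⟧ - ⟦ u ⟧) a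
  edge⇒block {a} {u} {v} _ (i , j , inj₁ step , or) =
    inj₁ (subst (⟦ v ⟧ - ⟦ u ⟧ ≈±_) (ℤP.*-identityʳ a) (step-difference a step or))
  edge⇒block {a} _ (i , j , inj₂ step , or) = inj₂ (step-difference a step or)

  step-exists : ∀ {a δ u v} → a ≉ 0ℤ → δ < p → ⟦ v ⟧ - ⟦ u ⟧ ≈ a * + δ →
                ∃[ i ] ∃[ j ] StepMod p δ i j × scale a i ≡ u × scale a j ≡ v
  step-exists {a} {δ} {u} {v} a≉0 δ<p v-u≈aδ with inverse a≉0
  ... | b , ab≈1 = scale b u , scale b v , ≈⇒StepMod {δ} {scale b u} {scale b v} δ<p (begin
    ⟦ scale b v ⟧                     ≈⟨ ⟦scale⟧ b v ⟩
    b * ⟦ v ⟧                         ≡⟨ eq₁ b ⟦ u ⟧ ⟦ v ⟧ ⟩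
    b * ⟦ u ⟧ + b * (⟦ v ⟧ - ⟦ u ⟧)   ≈⟨ +-cong (≈-refl {b * ⟦ u ⟧}) (*-congˡ b v-u≈aδ) ⟩
    b * ⟦ u ⟧ + b * (a * + δ)         ≡⟨ eq₂ b ⟦ u ⟧ a (+ δ) ⟩
    b * ⟦ u ⟧ + a * b * + δ           ≈⟨ +-cong (≈-sym (⟦scale⟧ b u)) (*-congʳ (+ δ) ab≈1) ⟩
    ⟦ scale b u ⟧ + 1ℤ * + δ          ≡⟨ cong₂ _+_ (refl {x = ⟦ scale b u ⟧}) (ℤP.*-identityˡ (+ δ)) ⟩
    ⟦ scale b u ⟧ + + δ               ∎) , scale-inverse {a} {b} ab≈1 u , scale-inverse {a} {b} ab≈1 v
    where
    open ≈-Reasoning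
    eq₁ : ∀ b u v → b * v ≡ b * u + b * (v - u)
    eq₁ = solve-∀
    eq₂ : ∀ b u a δ → b * u + b * (a * δ) ≡ b * u + a * b * δ
    eq₂ = solve-∀

  oriented-step : ∀ {a δ u v} → a ≉ 0ℤ → δ < p → ⟦ v ⟧ - ⟦ u ⟧ ≈± a * + δ →
                  ∃[ i ] ∃[ j ] StepMod p δ i j × Oriented a i j u v
  oriented-step {a} {δ} {u} {v} a≉0 δ<p (inj₁ v-u≈aδ) =
    map₂ (map₂ (map₂ inj₁)) (step-exists {a} {δ} {u} {v} a≉0 δ<p v-u≈aδ)
  oriented-step {a} {δ} {u} {v} a≉0 δ<p (inj₂ v-u≈-aδ) =
    map₂ (map₂ (map₂ inj₂)) (step-exists {a} {δ} {v} {u} a≉0 δ<p (-‿swap {⟦ u ⟧} {⟦ v ⟧} v-u≈-aδ))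

  block⇒edge : ∀ {a u v} → 2 < p → (a≉0 : a ≉ 0ℤ) →
               InBlock (⟦ v ⟧ - ⟦ u ⟧) a → EdgeIn (multiplierCopy a≉0) u v
  block⇒edge {a} {u} {v} 2<p a≉0 (inj₁ v-u≈±a) =
    map₂ (map₂ (map₁ inj₁)) (oriented-step {a} {1} {u} {v} a≉0 (ℕP.<-trans (s≤s (s≤s z≤n)) 2<p)
      (subst (⟦ v ⟧ - ⟦ u ⟧ ≈±_) (sym (ℤP.*-identityʳ a)) v-u≈±a))
  block⇒edge {a} {u} {v} 2<p a≉0 (inj₂ v-u≈±2a) =
    map₂ (map₂ (map₁ inj₂)) (oriented-step {a} {2} {u} {v} a≉0 2<p v-u≈±2a)

uniqueCover⇒decomposition :
  ∀ {p} n {Q : ℕ → Set} → Decidable Q → (copy : ∀ {a} → Q a → SquareCycle p) →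
  (∀ u v → u ≢ v → ∃[ a ] a < n × Q a × (∀ q → EdgeIn (copy {a} q) u v)) →
  (∀ {u v a b} (qa : Q a) (qb : Q b) → EdgeIn (copy qa) u v → EdgeIn (copy qb) u v → a ≡ b) →
  SquareCycleDecomposition p
uniqueCover⇒decomposition {p} n {Q} Q? copy cover unique = length as , C , partition
  where
  as : List ℕ
  as = filter Q? (upTo n)
  Q-lookup : ∀ c → Q (lookup as c)
  Q-lookup c = proj₂ (∈-filter⁻ Q? {xs = upTo n} (∈-lookup c))
  C : Fin (length as) → SquareCycle p
  C c = copy (Q-lookup c)
  partition : ∀ u v → u ≢ v →
              Σ (Fin (length as)) λ c → EdgeIn (C c) u v × (∀ c′ → EdgeIn (C c′) u v → c′ ≡ c)
  partition u v u≢v with cover u v u≢v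
  ... | a , a<n , qa , edge = Any.index a∈as , edge-c , λ c′ e′ →
    lookup-injective (UniqueP.filter⁺ Q? (UniqueP.upTo⁺ n)) (trans (unique (Q-lookup c′) qa e′ (edge qa)) a≡)
    where
    a∈as : a ∈ as
    a∈as = ∈-filter⁺ Q? (∈-upTo⁺ a<n) qa
    a≡ : a ≡ lookup as (Any.index a∈as)
    a≡ = lookup-index a∈as
    edge-c : EdgeIn (C (Any.index a∈as)) u v
    edge-c = subst (λ b → ∀ (q : Q b) → EdgeIn (copy q) u v) a≡ edge (Q-lookup (Any.index a∈as))

squareCycleDecomposition : ∀ p → Prime p → 2 < p → ∀ k → IsOrderOf2Mod p k → 4 ∣ k → SquareCycleDecomposition p
squareCycleDecomposition p p-prime 2<p k order 4∣k = uniqueCover⇒decomposition p canonical? copy cover unique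
  where
  open CanonicalRepresentative p p-prime k order 4∣k
  open MultiplierCopy p p-prime using (⟦_⟧; ⟦⟧-injective; multiplierCopy; edge⇒block; block⇒edge)

  copy : ∀ {a} → Canonical a → SquareCycle p
  copy ca = multiplierCopy (canonical≉0 ca)

  cover : ∀ u v → u ≢ v → ∃[ a ] a < p × Canonical a × (∀ q → EdgeIn (copy {a} q) u v)
  cover u v u≢v = representative d , representative<p d , representative-canonical d≉0 ,
                  λ q → block⇒edge 2<p (canonical≉0 q) (InBlock-representative d)
    where
    d = ⟦ v ⟧ - ⟦ u ⟧
    d≉0 : d ≉ 0ℤ
    d≉0 d≈0 = u≢v (sym (⟦⟧-injective (-≈0⇒≈ d≈0)))

  unique : ∀ {u v a b} (qa : Canonical a) (qb : Canonical b) → EdgeIn (copy qa) u v → EdgeIn (copy qb) u v → a ≡ b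
  unique qa qb ea eb = trans (sym (representative-unique qa (edge⇒block (canonical≉0 qa) ea)))
                             (representative-unique qb (edge⇒block (canonical≉0 qb) eb))

[-1]^odd≡-1 : ∀ s → (- 1ℤ) ^ suc (2 ℕ.* s) ≡ - 1ℤ
[-1]^odd≡-1 s = cong (- 1ℤ *_) (trans (sym (ℤP.^-*-assoc (- 1ℤ) 2 s)) (ℤP.^-zeroˡ s))

order-of-2-divisible-by-4 : ∀ p → Prime p → p % 8 ≡ 5 → ∃[ k ] IsOrderOf2Mod p k × 4 ∣ k
order-of-2-divisible-by-4 p p-prime p%8≡5 = k , order , 2^≈-1⇒4∣k 2<p 2∣N 2^N≈-1
  where
  open PrimeModulus p p-prime
  c = suc (2 ℕ.* (p / 8))
  N = c ℕ.+ c
  p≡5+[p/8]*8 : p ≡ 5 ℕ.+ p / 8 ℕ.* 8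
  p≡5+[p/8]*8 = trans (ℕ%.m≡m%n+[m/n]*n p 8) (cong (ℕ._+ p / 8 ℕ.* 8) p%8≡5)
  2<p : 2 < p
  2<p = subst (2 <_) (sym p≡5+[p/8]*8) (s≤s (s≤s (s≤s z≤n)))
  p≡4c+1 : p ≡ 4 ℕ.* c ℕ.+ 1
  p≡4c+1 = trans p≡5+[p/8]*8 (eq (p / 8))
    where eq : ∀ s → 5 ℕ.+ s ℕ.* 8 ≡ 4 ℕ.* suc (2 ℕ.* s) ℕ.+ 1
          eq = ℕSolver.solve-∀
  2∣N : 2 ∣ N
  2∣N = divides c (trans (cong (λ n → c ℕ.+ n) (sym (ℕP.+-identityʳ c))) (ℕP.*-comm 2 c))
  2^N≈-1 : 2^ N ≈ - 1ℤ
  2^N≈-1 = ≈-trans (GaussLemmaForTwo.2^[c+c]≈[-1]^c p p-prime c p≡4c+1) (≈-reflexive ([-1]^odd≡-1 (p / 8)))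
  period = order-of-2-exists {2 ℕ.* N} (s≤s z≤n) (2^≈-1⇒2^[2n]≈1 {N} 2^N≈-1)
  k = proj₁ period
  order = proj₂ period
  open OrderOfTwo p p-prime k order using (2^≈-1⇒4∣k)

prime≡1[4]⇒2<p : ∀ {p} → Prime p → p % 4 ≡ 1 → 2 < p
prime≡1[4]⇒2<p {1} p-prime _ = contradiction p-prime ¬prime[1]
prime≡1[4]⇒2<p {suc (suc (suc (suc _)))} _ _ = s≤s (s≤s (s≤s z≤n))

theorem1p2 : ((p : ℕ) → Prime p → p % 4 ≡ 1 → ∃ (λ k → IsOrderOf2Mod p k × 4 ∣ k) → SquareCycleDecomposition p)
    × ((p : ℕ) → Prime p → p % 8 ≡ 5 → ∃ (λ k → IsOrderOf2Mod p k × 4 ∣ k))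
theorem1p2 = decompose , order-of-2-divisible-by-4
  where
  decompose : (p : ℕ) → Prime p → p % 4 ≡ 1 → ∃ (λ k → IsOrderOf2Mod p k × 4 ∣ k) → SquareCycleDecomposition p
  decompose p p-prime p%4≡1 (k , order , 4∣k) =
    squareCycleDecomposition p p-prime (prime≡1[4]⇒2<p p-prime p%4≡1) k order 4∣k
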